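{- Let $\sigma$ be a partition of a positive integer $r$ with largest part $\Delta \geq 2$, let $n,q$ be positive integers, and let $H=H(n,r,q\mid\sigma)$. Let $\alpha,\beta$ be integers with $2 \leq \alpha \leq s(\sigma) = \beta$, and suppose $n \geq s(\sigma)^2$ and $q \geq (\Delta-1)\beta +1$. Then in every $(\alpha,\beta)$-colouring of $H$ every class of $H$ is monochromatic; consequently the $(\alpha,\beta)$-spectrum of $H$ equals the $(\alpha,\beta)$-monochromatic zone of $H$.
   Context: For a partition $\sigma$ of $r$ and positive integers $n,q$, the $\sigma$-hypergraph $H(n,r,q\mid\sigma)$ is the $r$-uniform hypergraph whose vertex set has $nq$ vertices partitioned into $n$ classes $V_1,\dots,V_n$ of $q$ vertices each, and in which an $r$-subset $K$ of the vertex set is an edge if and only if the multiset of non-zero cardinalities $|K\cap V_i|$, $1\le i\le n$, is exactly the partition $\sigma$. $s(\sigma)$ denotes the number of parts of $\sigma$ and $\Delta$ its largest part. For integers $\alpha\le\beta$, an $(\alpha,\beta)$-colouring of a hypergraph is an assignment of colours to its vertices such that every edge contains at least $\alpha$ and at most $\beta$ distinct colours; a $k$-$(\alpha,\beta)$-colouring is one using exactly $k$ colours. The $(\alpha,\beta)$-spectrum is the set of all $k$ for which a $k$-$(\alpha,\beta)$-colouring exists. The $(\alpha,\beta)$-monochromatic zone of a $\sigma$-hypergraph is the set of all integers $k$ for which there exists a $k$-$(\alpha,\beta)$-colouring in which every class $V_i$ is monochromatic. -}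

module Defs where

open import Data.Nat using (ℕ; zero; suc; _+_; _*_; _∸_; _≤_; _<_; _⊔_)
open import Data.Bool using (Bool; true; false; _∧_)
open import Data.Fin using (Fin)
open import Data.Fin.Properties using () renaming (_≟_ to _≟F_)
open import Data.List using (List; []; _∷_; length; map; filter; foldr; allFin)
open import Data.Nat.ListAction using (sum)
open import Data.Bool.ListAction using (any)
open import Data.List.Relation.Unary.All using (All)
open import Data.List.Relation.Binary.Permutation.Propositional using (_↭_)
open import Data.Product using (Σ; _×_; _,_)
open import Relation.Nullary using (¬_; does)
open import Relation.Binary.PropositionalEquality using (_≡_)
open import Function.Definitions using (Surjective)

-- A partition σ of r: a list of positive parts summing to r.
-- The order of the parts is irrelevant (edges compare multisets via _↭_).
IsPartition : ℕ → List ℕ → Set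
IsPartition r σ = All (λ p → 1 ≤ p) σ × sum σ ≡ r

s : List ℕ → ℕ
s = length

Δ : List ℕ → ℕ
Δ = foldr _⊔_ 0

-- Vertex set: class index (Fin n) and position within the class (Fin q).
-- A vertex subset K ⊆ V is a Boolean predicate.
VSubset : ℕ → ℕ → Set
VSubset n q = Fin n → Fin q → Bool

b2n : Bool → ℕ
b2n true = 1
b2n false = 0

classCount : ∀ {n q} → VSubset n q → Fin n → ℕ
classCount {q = q} K i = sum (map (λ x → b2n (K i x)) (allFin q))

size : ∀ {n q} → VSubset n q → ℕ
size {n} K = sum (map (classCount K) (allFin n))

isNonzero : ℕ → Bool
isNonzero zero = false
isNonzero (suc _) = true

IsEdge : (n r q : ℕ) → List ℕ → VSubset n q → Set
IsEdge n r q σ K =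
  size K ≡ r × filter (λ m → 1 Data.Nat.≤? m) (map (classCount K) (allFin n)) ↭ σ

Colouring : ℕ → ℕ → ℕ → Set
Colouring n q k = Fin n → Fin q → Fin k

numColours : ∀ {n q k} → Colouring n q k → VSubset n q → ℕ
numColours {n} {q} {k} c K =
  length (filter (λ j → appears j Data.Bool.≟ true) (allFin k))
  where
  appears : Fin k → Bool
  appears j = any (λ i → any (λ x → K i x ∧ does (c i x ≟F j)) (allFin q)) (allFin n)

IsABColouring : (n r q : ℕ) (σ : List ℕ) (α β : ℕ) {k : ℕ} → Colouring n q k → Set
IsABColouring n r q σ α β c =
  ∀ K → IsEdge n r q σ K → α ≤ numColours c K × numColours c K ≤ β

Monochromatic : ∀ {n q k} → Colouring n q k → Fin n → Set
Monochromatic c i = ∀ x y → c i x ≡ c i y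

UsesExactly : ∀ {n q k} → Colouring n q k → Set
UsesExactly {n} {q} {k} c = ∀ (j : Fin k) → Σ (Fin n) λ i → Σ (Fin q) λ x → c i x ≡ j

InSpectrum : (n r q : ℕ) (σ : List ℕ) (α β k : ℕ) → Set
InSpectrum n r q σ α β k =
  Σ (Colouring n q k) λ c → UsesExactly c × IsABColouring n r q σ α β c

InMonoZone : (n r q : ℕ) (σ : List ℕ) (α β k : ℕ) → Set
InMonoZone n r q σ α β k =
  Σ (Colouring n q k) λ c → UsesExactly c × IsABColouring n r q σ α β c
    × (∀ i → Monochromatic c i)

-- Suppose a class V_{i₀} contains vertices x₀, y₀ of different colours. Greedily pick vertices in
-- further, pairwise distinct classes whose colours are pairwise distinct and new. If s(σ) − 1 such
-- vertices are found, an edge through all of them, with a part of size d ≥ 2 in V_{i₀} containing x₀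
-- and y₀, sees s(σ) + 1 > β colours. Otherwise the search gets stuck: for a set E of fewer than s(σ)
-- classes and a set C of at most s(σ) colours, every class outside E is coloured from C. Since
-- q > (Δ − 1)·s(σ), each such class has Δ vertices of a single colour of C, and since more than
-- (s(σ) − 1)·s(σ) classes lie outside E, some colour u ∈ C occurs Δ times in each of s(σ) classes.
-- These classes carry an edge coloured u alone, contradicting α ≥ 2.

module Submission where

open import Defs
open import Data.Bool using (Bool; true; false; T; not; _∧_; _∨_; if_then_else_)
import Data.Bool as Bool
open import Data.Bool.ListAction using (any)
open import Data.Bool.Properties using (T-∧; T-∨)
open import Data.Empty using (⊥; ⊥-elim)
open import Data.Fin using (Fin; zero; suc)
open import Data.Fin.Properties using (_≟_; suc-injective; any?)
open import Data.List using (List; []; _∷_; _++_; length; map; filter; tabulate; allFin)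
open import Data.List.Properties
  using (length-++; length-map; map-++; map-∘; ++-identityʳ; map-tabulate; tabulate-cong; filter-accept)
open import Data.List.Membership.Propositional using (_∈_; _∉_; lose; find)
open import Data.List.Membership.Propositional.Properties
  using (∈-allFin; ∈-map⁺; ∈-∃++; ∈-++⁺ˡ; ∈-++⁺ʳ)
import Data.List.Membership.DecPropositional as DecMembership
open import Data.List.Relation.Binary.Permutation.Propositional
  using (_↭_; ↭-refl; ↭-reflexive; ↭-prep; ↭-swap; ↭-sym; ↭-trans; module PermutationReasoning)
open import Data.List.Relation.Binary.Permutation.Propositional.Properties
  using (All-resp-↭; ↭-length; shift)
open import Data.List.Relation.Binary.Pointwise as Pointwise using (Pointwise; []; _∷_)
open import Data.List.Relation.Unary.All as All using (All; []; _∷_; lookup)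
open import Data.List.Relation.Unary.All.Properties using (All¬⇒¬Any; ¬Any⇒All¬; map⁺; map⁻; ++⁺)
open import Data.List.Relation.Unary.Any as Any using (Any; here; there; satisfied)
open import Data.List.Relation.Unary.Any.Properties using (any⁺; any⁻)
open import Data.List.Relation.Unary.Unique.Propositional using (Unique; []; _∷_)
open import Data.Nat hiding (_≟_)
open import Data.Nat.ListAction using (sum)
open import Data.Nat.ListAction.Properties using (sum-↭)
open import Data.Nat.Properties hiding (_≟_; suc-injective)
open import Algebra.Properties.CommutativeSemigroup +-commutativeSemigroup using (interchange)
open import Data.Product using (∃; _×_; _,_; proj₁; proj₂; uncurry)
open import Data.Sum using (inj₁; inj₂)
import Data.Vec.Functional as Vector
open import Function using (_∘_; id)
open import Function.Bundles using (Equivalence)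
open import Relation.Binary.PropositionalEquality
open import Relation.Nullary using (¬_; Dec; yes; no; does; ¬?; _×-dec_)
open import Relation.Nullary.Decidable using (decidable-stable)

open module FinMembership {m} = DecMembership (_≟_ {m}) using (_∈?_)

does-sound : ∀ {A : Set} (a? : Dec A) → T (does a?) → A
does-sound (yes a) _ = a

not-does-sound : ∀ {A : Set} (a? : Dec A) → T (not (does a?)) → ¬ A
not-does-sound (no ¬a) _ = ¬a

does-complete : ∀ {A : Set} (a? : Dec A) → A → T (does a?)
does-complete (yes _) _ = _
does-complete (no ¬a) a = ¬a a

-- Counting Boolean predicates on Fin m

count : ∀ {m} → (Fin m → Bool) → ℕ
count {zero}  P = 0
count {suc m} P = b2n (P zero) + count (P ∘ suc)

_⊆_ : ∀ {m} → (Fin m → Bool) → (Fin m → Bool) → Set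
P ⊆ Q = ∀ x → T (P x) → T (Q x)

⁅_⁆ : ∀ {m} → Fin m → (Fin m → Bool)
⁅ z ⁆ x = does (x ≟ z)

_∈ᵇ_ : ∀ {m} → Fin m → List (Fin m) → Bool
x ∈ᵇ ys = does (x ∈? ys)

count-cong : ∀ {m} {P Q : Fin m → Bool} → (∀ x → P x ≡ Q x) → count P ≡ count Q
count-cong {zero}  eq = refl
count-cong {suc m} eq = cong₂ _+_ (cong b2n (eq zero)) (count-cong (eq ∘ suc))

count-mono : ∀ {m} {P Q : Fin m → Bool} → P ⊆ Q → count P ≤ count Q
count-mono {zero}  P⊆Q = z≤n
count-mono {suc m} P⊆Q = +-mono-≤ (b2n-mono (P⊆Q zero)) (count-mono (P⊆Q ∘ suc))
  where
  b2n-mono : ∀ {a b} → (T a → T b) → b2n a ≤ b2n b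
  b2n-mono {false}         _   = z≤n
  b2n-mono {true}  {true}  _   = ≤-refl
  b2n-mono {true}  {false} a⇒b = ⊥-elim (a⇒b _)

count-false : ∀ {m} → count {m} (λ _ → false) ≡ 0
count-false {zero}  = refl
count-false {suc m} = count-false {m}

count-true : ∀ {m} → count {m} (λ _ → true) ≡ m
count-true {zero}  = refl
count-true {suc m} = cong suc (count-true {m})

count-∨-∧ : ∀ {m} (P Q : Fin m → Bool) →
            count P + count Q ≡ count (λ x → P x ∨ Q x) + count (λ x → P x ∧ Q x)
count-∨-∧ {zero}  P Q = refl
count-∨-∧ {suc m} P Q = begin
  (b2n a + count P′) + (b2n b + count Q′)                   ≡⟨ interchange (b2n a) _ (b2n b) _ ⟩
  (b2n a + b2n b) + (count P′ + count Q′)                   ≡⟨ cong₂ _+_ (b2n-∨-∧ a b) (count-∨-∧ P′ Q′) ⟩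
  (b2n (a ∨ b) + b2n (a ∧ b)) + (count P′∨Q′ + count P′∧Q′) ≡⟨ interchange (b2n (a ∨ b)) _ _ _ ⟩
  (b2n (a ∨ b) + count P′∨Q′) + (b2n (a ∧ b) + count P′∧Q′) ∎
  where
  open ≡-Reasoning
  a = P zero
  b = Q zero
  P′ = P ∘ suc
  Q′ = Q ∘ suc
  P′∨Q′ = λ x → P′ x ∨ Q′ x
  P′∧Q′ = λ x → P′ x ∧ Q′ x
  b2n-∨-∧ : ∀ a b → b2n a + b2n b ≡ b2n (a ∨ b) + b2n (a ∧ b)
  b2n-∨-∧ false false = refl
  b2n-∨-∧ false true  = refl
  b2n-∨-∧ true  false = refl
  b2n-∨-∧ true  true  = refl

count-∧-false : ∀ {m} {P Q : Fin m → Bool} → (∀ x → T (P x) → ¬ T (Q x)) →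
                count (λ x → P x ∧ Q x) ≡ 0
count-∧-false {m} {P} {Q} disjoint =
  n≤0⇒n≡0 (≤-trans (count-mono P∧Q⊆∅) (≤-reflexive (count-false {m})))
  where
  P∧Q⊆∅ : (λ x → P x ∧ Q x) ⊆ (λ _ → false)
  P∧Q⊆∅ x p∧q with P x | Q x | disjoint x
  ... | true | true | d = d _ _

count-∨-≤ : ∀ {m} (P Q : Fin m → Bool) → count (λ x → P x ∨ Q x) ≤ count P + count Q
count-∨-≤ P Q = ≤-trans (m≤m+n _ _) (≤-reflexive (sym (count-∨-∧ P Q)))

count-∨-disjoint : ∀ {m} {P Q : Fin m → Bool} → (∀ x → T (P x) → ¬ T (Q x)) →
                   count (λ x → P x ∨ Q x) ≡ count P + count Q
count-∨-disjoint {P = P} {Q} disjoint = begin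
  count (λ x → P x ∨ Q x)                            ≡⟨ +-identityʳ _ ⟨
  count (λ x → P x ∨ Q x) + 0                        ≡⟨ cong (count (λ x → P x ∨ Q x) +_) (count-∧-false disjoint) ⟨
  count (λ x → P x ∨ Q x) + count (λ x → P x ∧ Q x)  ≡⟨ count-∨-∧ P Q ⟨
  count P + count Q                                  ∎
  where open ≡-Reasoning

count-complement : ∀ {m} (P : Fin m → Bool) → count P + count (not ∘ P) ≡ m
count-complement {m} P = begin
  count P + count (not ∘ P)         ≡⟨ sym (count-∨-disjoint P-disjoint) ⟩
  count (λ x → P x ∨ not (P x))     ≡⟨ count-cong ∨-not ⟩
  count {m} (λ _ → true)            ≡⟨ count-true ⟩
  m                                 ∎
  where
  open ≡-Reasoning
  P-disjoint : ∀ x → T (P x) → ¬ T (not (P x))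
  P-disjoint x p with P x
  ... | true = λ ()
  ∨-not : ∀ x → P x ∨ not (P x) ≡ true
  ∨-not x with P x
  ... | true  = refl
  ... | false = refl

count-⁅⁆ : ∀ {m} (z : Fin m) → count ⁅ z ⁆ ≡ 1
count-⁅⁆ {suc m} zero    = cong suc (count-false {m})
count-⁅⁆ {suc m} (suc z) = count-⁅⁆ z

count-nonempty : ∀ {m} (P : Fin m → Bool) → 0 < count P → ∃ λ x → T (P x)
count-nonempty {suc m} P pos with P zero in eq
... | true  = zero , subst T (sym eq) _
... | false = let x , px = count-nonempty (P ∘ suc) pos in suc x , px

_-_ : ∀ {m} → (Fin m → Bool) → Fin m → (Fin m → Bool)
(P - i) j = not (⁅ i ⁆ j) ∧ P j

remove-⊆ : ∀ {m} (P : Fin m → Bool) i → (P - i) ⊆ P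
remove-⊆ P i j P-i∋j = proj₂ (Equivalence.to (T-∧ {not (⁅ i ⁆ j)}) P-i∋j)

removed-≢ : ∀ {m} (P : Fin m → Bool) i {j} → T ((P - i) j) → j ≢ i
removed-≢ P i {j} P-i∋j refl with j ≟ j
... | yes _   = P-i∋j
... | no  j≢j = j≢j refl

count-remove : ∀ {m} (P : Fin m → Bool) i → count P ≤ suc (count (P - i))
count-remove P i = begin
  count P                            ≤⟨ count-mono P⊆P-i+i ⟩
  count (λ j → (P - i) j ∨ ⁅ i ⁆ j)  ≤⟨ count-∨-≤ (P - i) ⁅ i ⁆ ⟩
  count (P - i) + count ⁅ i ⁆        ≡⟨ cong (count (P - i) +_) (count-⁅⁆ i) ⟩
  count (P - i) + 1                  ≡⟨ +-comm (count (P - i)) 1 ⟩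
  suc (count (P - i))                ∎
  where
  open ≤-Reasoning
  P⊆P-i+i : P ⊆ (λ j → (P - i) j ∨ ⁅ i ⁆ j)
  P⊆P-i+i j Pj with j ≟ i
  ... | yes _ = _
  ... | no  _ = Equivalence.from (T-∨ {P j}) (inj₁ Pj)

count-any-≤-sum : ∀ {m} {A : Set} (Q : A → Fin m → Bool) (us : List A) →
                  count (λ x → any (λ u → Q u x) us) ≤ sum (map (count ∘ Q) us)
count-any-≤-sum {m} Q []       = ≤-reflexive (count-false {m})
count-any-≤-sum     Q (u ∷ us) = ≤-trans (count-∨-≤ (Q u) (λ x → any (λ u → Q u x) us))
                                          (+-monoʳ-≤ (count (Q u)) (count-any-≤-sum Q us))

count-∈-≤-length : ∀ {m} (ys : List (Fin m)) → count (_∈ᵇ ys) ≤ length ys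
count-∈-≤-length {m} []       = ≤-reflexive (count-false {m})
count-∈-≤-length     (y ∷ ys) = ≤-trans (count-∨-≤ ⁅ y ⁆ (_∈ᵇ ys))
                                         (+-mono-≤ (≤-reflexive (count-⁅⁆ y)) (count-∈-≤-length ys))

count-∈-unique : ∀ {m} {ys : List (Fin m)} → Unique ys → count (_∈ᵇ ys) ≡ length ys
count-∈-unique {m} []                = count-false {m}
count-∈-unique {ys = y ∷ ys} (y∉ys ∷ unique) = begin
  count (λ x → ⁅ y ⁆ x ∨ x ∈ᵇ ys)  ≡⟨ count-∨-disjoint disjoint ⟩
  count ⁅ y ⁆ + count (_∈ᵇ ys)     ≡⟨ cong₂ _+_ (count-⁅⁆ y) (count-∈-unique unique) ⟩
  suc (length ys)                  ∎
  where
  open ≡-Reasoning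
  disjoint : ∀ x → T (⁅ y ⁆ x) → ¬ T (x ∈ᵇ ys)
  disjoint x x≡y x∈ys with refl ← does-sound (x ≟ y) x≡y =
    All¬⇒¬Any y∉ys (does-sound (x ∈? ys) x∈ys)

above-average : ∀ {A : Set} (f : A → ℕ) t (us : List A) → t * length us < sum (map f us) →
                ∃ λ u → u ∈ us × t < f u
above-average f t []       t*0<0 = ⊥-elim (n≮0 (subst (_< 0) (*-zeroʳ t) t*0<0))
above-average f t (u ∷ us) bound with t <? f u
... | yes t<fu = u , here refl , t<fu
... | no  t≮fu = let v , v∈us , t<fv = above-average f t us rest-bound in v , there v∈us , t<fv
  where
  rest-bound : t * length us < sum (map f us)
  rest-bound = +-cancelˡ-< t _ _ (begin-strict
    t + t * length us     ≡⟨ sym (*-suc t (length us)) ⟩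
    t * suc (length us)   <⟨ bound ⟩
    f u + sum (map f us)  ≤⟨ +-monoˡ-≤ _ (≮⇒≥ t≮fu) ⟩
    t + sum (map f us)    ∎)
    where open ≤-Reasoning

pigeonhole : ∀ {m} {A : Set} (P : Fin m → Bool) (Q : A → Fin m → Bool) (us : List A) t →
             (∀ x → T (P x) → Any (λ u → T (Q u x)) us) → t * length us < count P →
             ∃ λ u → u ∈ us × t < count (Q u)
pigeonhole P Q us t covered bound = above-average (count ∘ Q) t us (begin-strict
  t * length us                        <⟨ bound ⟩
  count P                              ≤⟨ count-mono (λ x px → any⁺ (λ u → Q u x) (covered x px)) ⟩
  count (λ x → any (λ u → Q u x) us)   ≤⟨ count-any-≤-sum Q us ⟩
  sum (map (count ∘ Q) us)             ∎)
  where open ≤-Reasoning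

subset-of-size : ∀ {m} (B : Fin m → Bool) p → p ≤ count B → ∃ λ S → S ⊆ B × count S ≡ p
subset-of-size {m}     B zero    _     = (λ _ → false) , (λ _ ()) , count-false {m}
subset-of-size {suc m} B (suc p) p<|B| with B zero in B₀
... | true  = let S , S⊆B , |S| = subset-of-size (B ∘ suc) p (s≤s⁻¹ p<|B|)
              in (true Vector.∷ S) , (λ { zero _ → subst T (sym B₀) _ ; (suc x) → S⊆B x }) , cong suc |S|
... | false = let S , S⊆B , |S| = subset-of-size (B ∘ suc) (suc p) p<|B|
              in (false Vector.∷ S) , (λ { zero () ; (suc x) → S⊆B x }) , |S|

superset-of-size : ∀ {m} (R : Fin m → Bool) p → count R ≤ p → p ≤ m → ∃ λ S → R ⊆ S × count S ≡ p
superset-of-size {m} R p |R|≤p p≤m = (λ x → R x ∨ S x) , R⊆R∨S , |R∨S|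
  where
  |¬R| : count (not ∘ R) ≡ m ∸ count R
  |¬R| = trans (sym (m+n∸m≡n (count R) _)) (cong (_∸ count R) (count-complement R))
  extra = subset-of-size (not ∘ R) (p ∸ count R)
                         (subst (p ∸ count R ≤_) (sym |¬R|) (∸-monoˡ-≤ (count R) p≤m))
  S = proj₁ extra
  R⊆R∨S : R ⊆ (λ x → R x ∨ S x)
  R⊆R∨S x rx with R x
  ... | true = _
  disjoint : ∀ x → T (R x) → ¬ T (S x)
  disjoint x rx sx with R x | proj₁ (proj₂ extra) x sx
  ... | true | ()
  |R∨S| : count (λ x → R x ∨ S x) ≡ p
  |R∨S| = begin
    count (λ x → R x ∨ S x)  ≡⟨ count-∨-disjoint disjoint ⟩
    count R + count S        ≡⟨ cong (count R +_) (proj₂ (proj₂ extra)) ⟩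
    count R + (p ∸ count R)  ≡⟨ m+[n∸m]≡n |R|≤p ⟩
    p                        ∎
    where open ≡-Reasoning

-- Class sizes and colours of a vertex set

sum-b2n-tabulate : ∀ {m} (P : Fin m → Bool) → sum (tabulate (b2n ∘ P)) ≡ count P
sum-b2n-tabulate {zero}  P = refl
sum-b2n-tabulate {suc m} P = cong (b2n (P zero) +_) (sum-b2n-tabulate (P ∘ suc))

sum-b2n-allFin : ∀ {m} (P : Fin m → Bool) → sum (map (b2n ∘ P) (allFin m)) ≡ count P
sum-b2n-allFin P = trans (cong sum (map-tabulate id (b2n ∘ P))) (sum-b2n-tabulate P)

classCount≡count : ∀ {n q} (K : VSubset n q) i → classCount K i ≡ count (K i)
classCount≡count K i = sum-b2n-allFin (K i)

length-filter-true : ∀ {A : Set} (P : A → Bool) xs →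
                     length (filter (λ x → P x Bool.≟ true) xs) ≡ sum (map (b2n ∘ P) xs)
length-filter-true P []       = refl
length-filter-true P (x ∷ xs) with P x
... | true  = cong suc (length-filter-true P xs)
... | false = length-filter-true P xs

module _ {n q k} (c : Colouring n q k) (K : VSubset n q) where

  appears : Fin k → Bool
  appears j = any (λ i → any (λ x → K i x ∧ does (c i x ≟ j)) (allFin q)) (allFin n)

  numColours≡count : numColours c K ≡ count appears
  numColours≡count = trans (length-filter-true appears (allFin k)) (sum-b2n-allFin appears)

  appears-intro : ∀ i x → T (K i x) → T (appears (c i x))
  appears-intro i x x∈K = any⁺ _ (lose (∈-allFin i) (any⁺ _ (lose (∈-allFin x)
    (Equivalence.from T-∧ (x∈K , does-complete (c i x ≟ c i x) refl)))))

  appears-elim : ∀ j → T (appears j) → ∃ λ i → ∃ λ x → T (K i x) × c i x ≡ j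
  appears-elim j j-appears =
    let i , x-found = satisfied (any⁻ _ (allFin n) j-appears)
        x , found   = satisfied (any⁻ _ (allFin q) x-found)
        x∈K , cx≡j  = Equivalence.to T-∧ found
    in i , x , x∈K , does-sound (c i x ≟ j) cx≡j

  numColours-≤1 : ∀ u → (∀ i x → T (K i x) → c i x ≡ u) → numColours c K ≤ 1
  numColours-≤1 u monochromatic = begin
    numColours c K  ≡⟨ numColours≡count ⟩
    count appears   ≤⟨ count-mono only-u ⟩
    count ⁅ u ⁆     ≡⟨ count-⁅⁆ u ⟩
    1               ∎
    where
    open ≤-Reasoning
    only-u : appears ⊆ ⁅ u ⁆
    only-u j j-appears with i , x , x∈K , refl ← appears-elim j j-appears =
      does-complete (c i x ≟ u) (monochromatic i x x∈K)

  length≤numColours : ∀ {us} → Unique us → All (T ∘ appears) us → length us ≤ numColours c K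
  length≤numColours {us} unique all-appear = begin
    length us       ≡⟨ count-∈-unique unique ⟨
    count (_∈ᵇ us)  ≤⟨ count-mono (λ j → lookup all-appear ∘ does-sound (j ∈? us)) ⟩
    count appears   ≡⟨ numColours≡count ⟨
    numColours c K  ∎
    where open ≤-Reasoning

-- Parts of a partition

parts≤Δ : ∀ σ → All (_≤ Δ σ) σ
parts≤Δ []       = []
parts≤Δ (p ∷ σ) =
  m≤m⊔n p (Δ σ) ∷ All.map (λ p′≤Δσ → ≤-trans p′≤Δσ (m≤n⊔m p (Δ σ))) (parts≤Δ σ)

part-≥ : ∀ {m} σ → suc m ≤ Δ σ → Any (suc m ≤_) σ
part-≥ {m} (p ∷ σ) m<p⊔Δσ with suc m ≤? p | suc m ≤? Δ σ
... | yes m<p | _       = here m<p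
... | no  _   | yes m<Δσ = there (part-≥ σ m<Δσ)
... | no  m≮p | no m≮Δσ = ⊥-elim (n≮n m (≤-trans m<p⊔Δσ (⊔-lub (≮⇒≥ m≮p) (≮⇒≥ m≮Δσ))))

large-part : ∀ σ → 2 ≤ Δ σ → ∃ λ d → ∃ λ τ → σ ↭ d ∷ τ × 2 ≤ d
large-part σ 2≤Δσ =
  let d , d∈σ , 2≤d = find (part-≥ σ 2≤Δσ)
      ys , zs , σ≡ = ∈-∃++ d∈σ
  in d , ys ++ zs , subst (_↭ d ∷ ys ++ zs) (sym σ≡) (shift d ys zs) , 2≤d

-- Edges assembled from parts

nonzero : List ℕ → List ℕ
nonzero = filter (1 ≤?_)

nonzero-sum : ∀ xs → sum (nonzero xs) ≡ sum xs
nonzero-sum []           = refl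
nonzero-sum (zero  ∷ xs) = nonzero-sum xs
nonzero-sum (suc x ∷ xs) = cong (suc x +_) (nonzero-sum xs)

nonzero-zeros : ∀ {m} (g : Fin m → ℕ) → (∀ i → g i ≡ 0) → nonzero (tabulate g) ≡ []
nonzero-zeros {zero}  g zeros = refl
nonzero-zeros {suc m} g zeros with g zero | zeros zero
... | .0 | refl = nonzero-zeros (g ∘ suc) (zeros ∘ suc)

nonzero-update : ∀ {m} (g h : Fin m → ℕ) i → h i ≡ 0 → 1 ≤ g i → (∀ j → j ≢ i → g j ≡ h j) →
                 nonzero (tabulate g) ↭ g i ∷ nonzero (tabulate h)
nonzero-update g h zero hᵢ≡0 1≤gᵢ elsewhere
  rewrite filter-accept (1 ≤?_) {xs = tabulate (g ∘ suc)} 1≤gᵢ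
        | hᵢ≡0
        | tabulate-cong (λ j → elsewhere (suc j) λ ()) = ↭-refl
nonzero-update g h (suc i) hᵢ≡0 1≤gᵢ elsewhere rewrite elsewhere zero (λ ()) =
  nonzero-∷ (h zero) (g (suc i))
    (nonzero-update (g ∘ suc) (h ∘ suc) i hᵢ≡0 1≤gᵢ (λ j j≢i → elsewhere (suc j) (j≢i ∘ suc-injective)))
  where
  nonzero-∷ : ∀ x y {xs ys} → nonzero xs ↭ y ∷ nonzero ys → nonzero (x ∷ xs) ↭ y ∷ nonzero (x ∷ ys)
  nonzero-∷ zero    y xs↭ = xs↭
  nonzero-∷ (suc x) y xs↭ = ↭-trans (↭-prep (suc x) xs↭) (↭-swap (suc x) y ↭-refl)

module _ {n q : ℕ} where

  fromParts : List (Fin n × (Fin q → Bool)) → VSubset n q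
  fromParts []             i x = false
  fromParts ((j , S) ∷ A) i x = if does (i ≟ j) then S x else fromParts A i x

  fromParts-skip : ∀ {j S} A {i} → i ≢ j → ∀ x → fromParts ((j , S) ∷ A) i x ≡ fromParts A i x
  fromParts-skip {j} A {i} i≢j x with i ≟ j
  ... | yes i≡j = ⊥-elim (i≢j i≡j)
  ... | no  _   = refl

  fromParts-∉ : ∀ A {i} → i ∉ map proj₁ A → ∀ x → fromParts A i x ≡ false
  fromParts-∉ []             i∉ x = refl
  fromParts-∉ ((j , S) ∷ A) i∉ x =
    trans (fromParts-skip {S = S} A (i∉ ∘ here) x) (fromParts-∉ A (i∉ ∘ there) x)

  fromParts-∈ : ∀ {A} → Unique (map proj₁ A) → ∀ {i S} → (i , S) ∈ A →
                ∀ x → fromParts A i x ≡ S x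
  fromParts-∈ {(j , S) ∷ A} _ (here refl) x with j ≟ j
  ... | yes _   = refl
  ... | no  j≢j = ⊥-elim (j≢j refl)
  fromParts-∈ {(j , S) ∷ A} (j∉ ∷ unique) (there i∈A) x =
    trans (fromParts-skip {S = S} A (λ { refl → All¬⇒¬Any j∉ (∈-map⁺ proj₁ i∈A) }) x)
          (fromParts-∈ unique i∈A x)

  fromParts-elim : ∀ A {i x} → T (fromParts A i x) → ∃ λ S → (i , S) ∈ A × T (S x)
  fromParts-elim ((j , S) ∷ A) {i} x∈K with i ≟ j
  ... | yes refl = S , here refl , x∈K
  ... | no  _    = let S′ , i∈A , x∈S′ = fromParts-elim A x∈K in S′ , there i∈A , x∈S′

  nonzero-fromParts : ∀ {A} → Unique (map proj₁ A) → All (λ a → 1 ≤ count (proj₂ a)) A →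
                      nonzero (tabulate (count ∘ fromParts A)) ↭ map (count ∘ proj₂) A
  nonzero-fromParts {[]}          _ _ =
    ↭-reflexive (nonzero-zeros (count ∘ fromParts []) (λ _ → count-false {q}))
  nonzero-fromParts {(j , S) ∷ A} unique@(j∉ ∷ unique′) (1≤|S| ∷ positive) = begin
    nonzero (tabulate (count ∘ fromParts ((j , S) ∷ A)))
      ↭⟨ nonzero-update _ _ j |Aⱼ|≡0 (subst (1 ≤_) (sym |Kⱼ|≡|S|) 1≤|S|)
                        (λ i i≢j → count-cong (fromParts-skip A i≢j)) ⟩
    count (fromParts ((j , S) ∷ A) j) ∷ nonzero (tabulate (count ∘ fromParts A))
      ≡⟨ cong (_∷ _) |Kⱼ|≡|S| ⟩
    count S ∷ nonzero (tabulate (count ∘ fromParts A))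
      ↭⟨ ↭-prep (count S) (nonzero-fromParts unique′ positive) ⟩
    count S ∷ map (count ∘ proj₂) A ∎
    where
    open PermutationReasoning
    |Kⱼ|≡|S| : count (fromParts ((j , S) ∷ A) j) ≡ count S
    |Kⱼ|≡|S| = count-cong (fromParts-∈ unique (here refl))
    |Aⱼ|≡0 : count (fromParts A j) ≡ 0
    |Aⱼ|≡0 = trans (count-cong (fromParts-∉ A (All¬⇒¬Any j∉))) (count-false {q})

  fromParts-isEdge : ∀ {r σ A} → IsPartition r σ → Unique (map proj₁ A) →
                     map (count ∘ proj₂) A ↭ σ →
                     IsEdge n r q σ (fromParts A)
  fromParts-isEdge {r} {σ} {A} (positive , sum≡r) unique sizes = size≡r , nonzero-classCounts
    where
    classCounts : map (classCount (fromParts A)) (allFin n) ≡ tabulate (count ∘ fromParts A)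
    classCounts = trans (map-tabulate id _) (tabulate-cong (classCount≡count (fromParts A)))
    nonzero↭σ : nonzero (tabulate (count ∘ fromParts A)) ↭ σ
    nonzero↭σ = ↭-trans (nonzero-fromParts unique (map⁻ (All-resp-↭ (↭-sym sizes) positive))) sizes
    nonzero-classCounts : nonzero (map (classCount (fromParts A)) (allFin n)) ↭ σ
    nonzero-classCounts rewrite classCounts = nonzero↭σ
    size≡r : size (fromParts A) ≡ r
    size≡r = begin
      size (fromParts A)                               ≡⟨ cong sum classCounts ⟩
      sum (tabulate (count ∘ fromParts A))             ≡⟨ nonzero-sum (tabulate (count ∘ fromParts A)) ⟨
      sum (nonzero (tabulate (count ∘ fromParts A)))   ≡⟨ sum-↭ nonzero↭σ ⟩
      sum σ                                            ≡⟨ sum≡r ⟩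
      r                                                ∎
      where open ≡-Reasoning

module _ {n q : ℕ} (W : VSubset n q) (D : ℕ) where

  partsWithin : (G : Fin n → Bool) (τ : List ℕ) → length τ ≤ count G → All (_≤ D) τ →
                (∀ i → T (G i) → D ≤ count (W i)) →
                ∃ λ A → Unique (map proj₁ A) × map (count ∘ proj₂) A ≡ τ ×
                        All (λ a → T (G (proj₁ a)) × proj₂ a ⊆ W (proj₁ a)) A
  partsWithin G []      _         _           _    = [] , [] , refl , []
  partsWithin G (p ∷ τ) 1+|τ|≤|G| (p≤D ∷ τ≤D) rich =
    let i , Gi              = count-nonempty G (≤-trans (s≤s z≤n) 1+|τ|≤|G|)
        S , S⊆Wi , |S|≡p    = subset-of-size (W i) p (≤-trans p≤D (rich i Gi))
        |τ|≤|G-i|           = s≤s⁻¹ (≤-trans 1+|τ|≤|G| (count-remove G i))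
        A , unique , sizes , inA =
          partsWithin (G - i) τ |τ|≤|G-i| τ≤D (λ j G-i∋j → rich j (remove-⊆ G i j G-i∋j))
    in (i , S) ∷ A ,
       map⁺ (All.map (λ G-i∋j → removed-≢ G i G-i∋j ∘ sym) (All.map proj₁ inA)) ∷ unique ,
       cong₂ _∷_ |S|≡p sizes ,
       (Gi , S⊆Wi) ∷ All.map (λ (G-i∋j , S⊆W) → remove-⊆ G i _ G-i∋j , S⊆W) inA

enlarge : ∀ {n q} (A : List (Fin n × (Fin q → Bool))) τ →
          Pointwise (λ a p → count (proj₂ a) ≤ p × p ≤ q) A τ →
          ∃ λ A′ → map proj₁ A′ ≡ map proj₁ A × map (count ∘ proj₂) A′ ≡ τ ×
                   (∀ {i R} → (i , R) ∈ A → ∃ λ S → (i , S) ∈ A′ × R ⊆ S)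
enlarge []             []      []                     = [] , refl , refl , λ ()
enlarge ((i , R) ∷ A) (p ∷ τ) ((|R|≤p , p≤q) ∷ fits) =
  let S , R⊆S , |S|≡p            = superset-of-size R p |R|≤p p≤q
      A′ , classes , sizes , ⊆A′ = enlarge A τ fits
  in (i , S) ∷ A′ , cong (i ∷_) classes , cong₂ _∷_ |S|≡p sizes ,
     λ { (here refl)  → S , here refl , R⊆S
       ; (there iR∈A) → let S′ , iS′∈A′ , R⊆S′ = ⊆A′ iR∈A in S′ , there iS′∈A′ , R⊆S′ }

module _ {n r q : ℕ} {σ : List ℕ} (σ-partition : IsPartition r σ) where

  edge-within : (W : VSubset n q) (G : Fin n → Bool) → s σ ≤ count G →
                (∀ i → T (G i) → Δ σ ≤ count (W i)) →
                ∃ λ K → IsEdge n r q σ K × (∀ i x → T (K i x) → T (W i x))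
  edge-within W G s≤|G| rich =
    let A , unique , sizes , inA = partsWithin W (Δ σ) G σ s≤|G| (parts≤Δ σ) rich
        K⊆W : ∀ i x → T (fromParts A i x) → T (W i x)
        K⊆W i x x∈K = let S , iS∈A , x∈S = fromParts-elim A x∈K in proj₂ (lookup inA iS∈A) x x∈S
    in fromParts A , fromParts-isEdge σ-partition unique (↭-reflexive sizes) , K⊆W

  edge-through : (A : List (Fin n × (Fin q → Bool))) (τ : List ℕ) → Unique (map proj₁ A) →
                 Pointwise (λ a p → count (proj₂ a) ≤ p × p ≤ q) A τ → τ ↭ σ →
                 ∃ λ K → IsEdge n r q σ K × (∀ {i R} → (i , R) ∈ A → R ⊆ K i)
  edge-through A τ unique fits τ↭σ =
    let A′ , classes , sizes , ⊆A′ = enlarge A τ fits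
        unique′ = subst Unique (sym classes) unique
        R⊆K : ∀ {i R} → (i , R) ∈ A → R ⊆ fromParts A′ i
        R⊆K iR∈A x x∈R = let S , iS∈A′ , R⊆S = ⊆A′ iR∈A
                         in subst T (sym (fromParts-∈ unique′ iS∈A′ x)) (R⊆S x x∈R)
    in fromParts A′ , fromParts-isEdge σ-partition unique′ (↭-trans (↭-reflexive sizes) τ↭σ) , R⊆K

-- Colour classes are monochromatic

pred[m]<n⇒m≤n : ∀ {m n} → pred m < n → m ≤ n
pred[m]<n⇒m≤n {zero}  _ = z≤n
pred[m]<n⇒m≤n {suc m} m<n = m<n

pred[m]*m+n<m*m : ∀ {m n} → n < m → pred m * m + n < m * m
pred[m]*m+n<m*m {suc m} {n} n<m = begin-strict
  m * suc m + n      ≡⟨ +-comm (m * suc m) n ⟩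
  n + m * suc m      <⟨ +-monoˡ-< (m * suc m) n<m ⟩
  suc m * suc m      ∎
  where open ≤-Reasoning

module _ {n r q k α β : ℕ} {σ : List ℕ} (σ-partition : IsPartition r σ) (2≤Δ : 2 ≤ Δ σ)
         (2≤α : 2 ≤ α) (β≡s : β ≡ s σ) (s²≤n : s σ * s σ ≤ n) (q-large : (Δ σ ∸ 1) * β + 1 ≤ q)
         (c : Colouring n q k) (c-coloured : IsABColouring n r q σ α β c) where

  private
    split = large-part σ 2≤Δ
    d = proj₁ split
    τ = proj₁ (proj₂ split)
    σ↭d∷τ = proj₁ (proj₂ (proj₂ split))
    2≤d = proj₂ (proj₂ (proj₂ split))

    s≡1+|τ| : s σ ≡ suc (length τ)
    s≡1+|τ| = ↭-length σ↭d∷τ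

    Δ≤q : Δ σ ≤ q
    Δ≤q = begin
      Δ σ                       ≤⟨ m≤n+m∸n (Δ σ) 1 ⟩
      1 + pred (Δ σ)            ≡⟨ +-comm 1 (pred (Δ σ)) ⟩
      pred (Δ σ) + 1            ≡⟨ cong (_+ 1) (*-identityʳ (pred (Δ σ))) ⟨
      pred (Δ σ) * 1 + 1        ≤⟨ +-monoˡ-≤ 1 (*-monoʳ-≤ (pred (Δ σ)) 1≤β) ⟩
      pred (Δ σ) * β + 1        ≤⟨ q-large ⟩
      q                         ∎
      where
      open ≤-Reasoning
      1≤β : 1 ≤ β
      1≤β = subst (1 ≤_) (sym (trans β≡s s≡1+|τ|)) (s≤s z≤n)

  ¬rich-colour : ∀ u (G : Fin n → Bool) → s σ ≤ count G →
                 (∀ i → T (G i) → Δ σ ≤ count (λ x → does (c i x ≟ u))) → ⊥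
  ¬rich-colour u G s≤|G| rich =
    let K , K-edge , K-coloured-u = edge-within σ-partition (λ i x → does (c i x ≟ u)) G s≤|G| rich
        α≤#K , _ = c-coloured K K-edge
        #K≤1 = numColours-≤1 c K u (λ i x x∈K → does-sound (c i x ≟ u) (K-coloured-u i x x∈K))
    in n≮n 1 (≤-trans 2≤α (≤-trans α≤#K #K≤1))

  ¬confined : (E : List (Fin n)) (C : List (Fin k)) → length E < s σ → length C ≤ s σ →
              (∀ i x → i ∉ E → c i x ∈ C) → ⊥
  ¬confined E C |E|<s |C|≤s confined =
    let u , _ , pred[s]<|richᵤ| = pigeonhole outside rich C (pred (s σ)) rich-colour-in-C many-outside
    in ¬rich-colour u (rich u) (pred[m]<n⇒m≤n pred[s]<|richᵤ|)
                    (λ i richᵤi → does-sound (Δ σ ≤? count (λ x → does (c i x ≟ u))) richᵤi)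
    where
    rich : Fin k → Fin n → Bool
    rich u i = does (Δ σ ≤? count (λ x → does (c i x ≟ u)))

    outside : Fin n → Bool
    outside i = not (i ∈ᵇ E)

    few-colours : pred (Δ σ) * length C < count {q} (λ _ → true)
    few-colours = begin-strict
      pred (Δ σ) * length C     ≤⟨ *-monoʳ-≤ (pred (Δ σ)) (subst (length C ≤_) (sym β≡s) |C|≤s) ⟩
      pred (Δ σ) * β            <⟨ m<m+n _ z<s ⟩
      pred (Δ σ) * β + 1        ≤⟨ q-large ⟩
      q                         ≡⟨ count-true ⟨
      count {q} (λ _ → true)    ∎
      where open ≤-Reasoning

    rich-colour-in-C : ∀ i → T (outside i) → Any (λ u → T (rich u i)) C
    rich-colour-in-C i i-outside =
      let i∉E = not-does-sound (i ∈? E) i-outside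
          u , u∈C , pred[Δ]<|u| = pigeonhole (λ _ → true) (λ u x → does (c i x ≟ u)) C (pred (Δ σ))
                                    (λ x _ → Any.map (does-complete (c i x ≟ _)) (confined i x i∉E))
                                    few-colours
      in lose u∈C (does-complete (Δ σ ≤? _) (pred[m]<n⇒m≤n pred[Δ]<|u|))

    many-outside : pred (s σ) * length C < count outside
    many-outside = +-cancelʳ-< (length E) _ _ (begin-strict
      pred (s σ) * length C + length E   ≤⟨ +-monoˡ-≤ (length E) (*-monoʳ-≤ (pred (s σ)) |C|≤s) ⟩
      pred (s σ) * s σ + length E        <⟨ pred[m]*m+n<m*m |E|<s ⟩
      s σ * s σ                          ≤⟨ s²≤n ⟩
      n                                  ≡⟨ count-complement (_∈ᵇ E) ⟨
      count (_∈ᵇ E) + count outside      ≤⟨ +-monoˡ-≤ (count outside) (count-∈-≤-length E) ⟩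
      length E + count outside           ≡⟨ +-comm (length E) (count outside) ⟩
      count outside + length E           ∎)
      where open ≤-Reasoning

  module _ (i₀ : Fin n) (x₀ y₀ : Fin q) (a≢b : c i₀ x₀ ≢ c i₀ y₀) where

    spine : List (Fin n × Fin q) → List (Fin n × Fin q)
    spine L = L ++ (i₀ , x₀) ∷ (i₀ , y₀) ∷ []

    classes : List (Fin n × Fin q) → List (Fin n)
    classes L = map proj₁ L ++ i₀ ∷ []

    colours : List (Fin n × Fin q) → List (Fin k)
    colours L = map (uncurry c) (spine L)

    Rainbow : List (Fin n × Fin q) → Set
    Rainbow L = Unique (classes L) × Unique (colours L)

    length-classes : ∀ L → length (classes L) ≡ length L + 1
    length-classes L = trans (length-++ (map proj₁ L)) (cong (_+ 1) (length-map proj₁ L))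

    length-colours : ∀ L → length (colours L) ≡ length L + 2
    length-colours L = trans (length-map (uncurry c) (spine L)) (length-++ L)

    extend-rainbow : ∀ L → Rainbow L → length L < length τ → ∃ λ v → Rainbow (v ∷ L)
    extend-rainbow L (unique-classes , unique-colours) |L|<|τ|
      with any? (λ i → any? (λ x → ¬? (i ∈? classes L) ×-dec ¬? (c i x ∈? colours L)))
    ... | yes (i , x , i∉ , cx∉) =
      (i , x) , ¬Any⇒All¬ _ i∉ ∷ unique-classes , ¬Any⇒All¬ _ cx∉ ∷ unique-colours
    ... | no  none = ⊥-elim (¬confined (classes L) (colours L) |E|<s |C|≤s confined)
      where
      confined : ∀ i x → i ∉ classes L → c i x ∈ colours L
      confined i x i∉ = decidable-stable (c i x ∈? colours L) (λ cx∉ → none (i , x , i∉ , cx∉))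
      |E|<s : length (classes L) < s σ
      |E|<s = subst₂ _<_ (sym (trans (length-classes L) (+-comm _ 1))) (sym s≡1+|τ|) (s≤s |L|<|τ|)
      |C|≤s : length (colours L) ≤ s σ
      |C|≤s = subst₂ _≤_ (sym (trans (length-colours L) (+-comm _ 2))) (sym s≡1+|τ|) (s≤s |L|<|τ|)

    rainbow-of-length : ∀ m → m ≤ length τ → ∃ λ L → Rainbow L × length L ≡ m
    rainbow-of-length zero    _       = [] , ([] ∷ [] , (a≢b ∷ []) ∷ [] ∷ []) , refl
    rainbow-of-length (suc m) m<|τ| =
      let L , rainbow , |L|≡m = rainbow-of-length m (<⇒≤ m<|τ|)
          v , rainbow′ = extend-rainbow L rainbow (subst (_< length τ) (sym |L|≡m) m<|τ|)
      in v ∷ L , rainbow′ , cong suc |L|≡m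

    edge-through-spine : ∀ L → Unique (classes L) → length L ≡ length τ →
                         ∃ λ K → IsEdge n r q σ K × All (λ v → T (K (proj₁ v) (proj₂ v))) (spine L)
    edge-through-spine L unique-classes |L|≡|τ| =
      let K , K-edge , anchors⊆K = edge-through σ-partition anchors (τ ++ d ∷ []) unique-anchors fits τd↭σ
          pair⊆K = anchors⊆K (∈-++⁺ʳ (map anchor L) (here refl))
      in K , K-edge ,
         ++⁺ (All.tabulate λ {(i , z)} iz∈L →
                anchors⊆K (∈-++⁺ˡ (∈-map⁺ anchor iz∈L)) z (does-complete (z ≟ z) refl))
             (pair⊆K x₀ (Equivalence.from (T-∨ {does (x₀ ≟ x₀)}) (inj₁ (does-complete (x₀ ≟ x₀) refl))) ∷
              pair⊆K y₀ (Equivalence.from (T-∨ {does (y₀ ≟ x₀)}) (inj₂ (does-complete (y₀ ≟ y₀) refl))) ∷ [])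
      where
      anchor : Fin n × Fin q → Fin n × (Fin q → Bool)
      anchor (i , z) = i , ⁅ z ⁆
      pair : Fin q → Bool
      pair x = ⁅ x₀ ⁆ x ∨ ⁅ y₀ ⁆ x
      x₀∈pair : T (pair x₀)
      x₀∈pair = Equivalence.from (T-∨ {does (x₀ ≟ x₀)}) (inj₁ (does-complete (x₀ ≟ x₀) refl))
      y₀∈pair : T (pair y₀)
      y₀∈pair = Equivalence.from (T-∨ {does (y₀ ≟ x₀)}) (inj₂ (does-complete (y₀ ≟ y₀) refl))
      anchors : List (Fin n × (Fin q → Bool))
      anchors = map anchor L ++ (i₀ , pair) ∷ []

      unique-anchors : Unique (map proj₁ anchors)
      unique-anchors = subst Unique (sym (trans (map-++ proj₁ (map anchor L) _)
                                                (cong (_++ i₀ ∷ []) (sym (map-∘ L)))))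
                             unique-classes

      parts-fit : All (λ p → 1 ≤ p × p ≤ q) (d ∷ τ)
      parts-fit = All-resp-↭ σ↭d∷τ
        (All.zip (proj₁ σ-partition , All.map (λ p≤Δ → ≤-trans p≤Δ Δ≤q) (parts≤Δ σ)))

      singletons-fit : ∀ L τ → length L ≡ length τ → All (λ p → 1 ≤ p × p ≤ q) τ →
                       Pointwise (λ a p → count (proj₂ a) ≤ p × p ≤ q) (map anchor L) τ
      singletons-fit []      []      _ _ = []
      singletons-fit (v ∷ L) (p ∷ τ) |L|≡|τ| ((1≤p , p≤q) ∷ fit) =
        (subst (_≤ p) (sym (count-⁅⁆ (proj₂ v))) 1≤p , p≤q) ∷ singletons-fit L τ (cong pred |L|≡|τ|) fit

      |pair|≤d : count pair ≤ d
      |pair|≤d = begin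
        count pair                   ≤⟨ count-∨-≤ ⁅ x₀ ⁆ ⁅ y₀ ⁆ ⟩
        count ⁅ x₀ ⁆ + count ⁅ y₀ ⁆  ≡⟨ cong₂ _+_ (count-⁅⁆ x₀) (count-⁅⁆ y₀) ⟩
        2                            ≤⟨ 2≤d ⟩
        d                            ∎
        where open ≤-Reasoning

      fits : Pointwise (λ a p → count (proj₂ a) ≤ p × p ≤ q) anchors (τ ++ d ∷ [])
      fits with (_ , d≤q) ∷ τ-fits ← parts-fit =
        Pointwise.++⁺ (singletons-fit L τ |L|≡|τ| τ-fits) ((|pair|≤d , d≤q) ∷ [])

      τd↭σ : τ ++ d ∷ [] ↭ σ
      τd↭σ = begin
        τ ++ d ∷ []   ↭⟨ shift d τ [] ⟩
        d ∷ τ ++ []   ≡⟨ cong (d ∷_) (++-identityʳ τ) ⟩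
        d ∷ τ         ↭⟨ ↭-sym σ↭d∷τ ⟩
        σ             ∎
        where open PermutationReasoning

    ¬rainbow-edge : ∀ L → Rainbow L → length L ≡ length τ → ⊥
    ¬rainbow-edge L (unique-classes , unique-colours) |L|≡|τ| =
      let K , K-edge , spine⊆K = edge-through-spine L unique-classes |L|≡|τ|
          _ , #K≤β = c-coloured K K-edge
          colours-appear = map⁺ (All.map (λ {v} → appears-intro c K (proj₁ v) (proj₂ v)) spine⊆K)
      in n≮n β (begin-strict
        β                    ≡⟨ trans β≡s s≡1+|τ| ⟩
        suc (length τ)       <⟨ n<1+n _ ⟩
        2 + length τ         ≡⟨ +-comm 2 (length τ) ⟩
        length τ + 2         ≡⟨ trans (length-colours L) (cong (_+ 2) |L|≡|τ|) ⟨
        length (colours L)   ≤⟨ length≤numColours c K unique-colours colours-appear ⟩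
        numColours c K       ≤⟨ #K≤β ⟩
        β                    ∎)
      where open ≤-Reasoning

    two-colours-impossible : ⊥
    two-colours-impossible =
      let L , rainbow , |L|≡|τ| = rainbow-of-length (length τ) ≤-refl in ¬rainbow-edge L rainbow |L|≡|τ|

  classes-monochromatic : ∀ i → Monochromatic c i
  classes-monochromatic i x y with c i x ≟ c i y
  ... | yes cx≡cy = cx≡cy
  ... | no  cx≢cy = ⊥-elim (two-colours-impossible i x y cx≢cy)

theorem3p3 : (r : ℕ) (σ : List ℕ) → 0 < r → IsPartition r σ → 2 ≤ Δ σ →
    (n q : ℕ) → 0 < n → 0 < q →
    (α β : ℕ) → 2 ≤ α → α ≤ s σ → β ≡ s σ →
    s σ * s σ ≤ n → (Δ σ ∸ 1) * β + 1 ≤ q →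
    ((k : ℕ) (c : Colouring n q k) → IsABColouring n r q σ α β c →
        (i : Fin n) → Monochromatic c i)
    × ((k : ℕ) → (InSpectrum n r q σ α β k → InMonoZone n r q σ α β k)
                × (InMonoZone n r q σ α β k → InSpectrum n r q σ α β k))
theorem3p3 r σ _ σ-partition 2≤Δ n q _ _ α β 2≤α _ β≡s s²≤n q-large =
  monochromatic , λ k → spectrum⊆zone k , zone⊆spectrum k
  where
  monochromatic : (k : ℕ) (c : Colouring n q k) → IsABColouring n r q σ α β c → ∀ i → Monochromatic c i
  monochromatic k c c-coloured = classes-monochromatic σ-partition 2≤Δ 2≤α β≡s s²≤n q-large c c-coloured

  spectrum⊆zone : ∀ k → InSpectrum n r q σ α β k → InMonoZone n r q σ α β k
  spectrum⊆zone k (c , surjective , c-coloured) = c , surjective , c-coloured , monochromatic k c c-coloured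

  zone⊆spectrum : ∀ k → InMonoZone n r q σ α β k → InSpectrum n r q σ α β k
  zone⊆spectrum k (c , surjective , c-coloured , _) = c , surjective , c-coloured
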